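{- For every integer $h\ge0$, the generating function (by length) of open Deutsch paths staying within the strip $0\le y\le h$ is \[ (1+v+v^2)\,\frac{1-v^{h+1}}{1-v^{h+3}}, \] and the generating function of all open Deutsch paths (no upper bound) is $1+v+v^2$, which equals the generating function $M(z)=\frac{1-z-\sqrt{1-2z-3z^2}}{2z^2}$ of Motzkin paths. In particular, for every $n\ge0$, the number of open Deutsch paths of length $n$ equals the Motzkin number $M_n=[z^n]M(z)$.
   Context: A Deutsch path of length $n$ is a lattice path starting at $(0,0)$ consisting of $n$ steps, each either an up-step $(1,1)$ or a down-step $(1,-k)$ for some integer $k\ge1$, which never goes below the $x$-axis. An open Deutsch path is a Deutsch path with arbitrary ending level; the empty path counts. A Motzkin path of length $n$ is a lattice path from $(0,0)$ to $(n,0)$ with steps $(1,1)$, $(1,0)$, $(1,-1)$ never going below the $x$-axis. Let $v=v(z)=\frac{1-z-\sqrt{1-2z-3z^2}}{2z}$, the formal power series satisfying $z=\frac{v}{1+v+v^2}$. -}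

module Defs where

open import Data.Nat as ℕ using (ℕ; zero; suc; _∸_)
open import Data.Integer as ℤ using (ℤ; +_; _+_; _*_; -_; _≤_; _-_)
open import Data.List using (List; []; _∷_; length)
open import Data.List.Relation.Unary.All using (All)
open import Data.Product using (Σ; _×_)
open import Data.Fin using (Fin)
open import Function.Bundles using (_↔_)
open import Relation.Binary.PropositionalEquality using (_≡_)

FPS : Set
FPS = ℕ → ℤ

sumUpTo : ℕ → (ℕ → ℤ) → ℤ
sumUpTo zero    f = f 0
sumUpTo (suc n) f = sumUpTo n f + f (suc n)

_≈ₛ_ : FPS → FPS → Set
f ≈ₛ g = ∀ n → f n ≡ g n
infix 4 _≈ₛ_

_⊕_ : FPS → FPS → FPS
(f ⊕ g) n = f n + g n
infixl 6 _⊕_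

_⊖_ : FPS → FPS → FPS
(f ⊖ g) n = f n - g n
infixl 6 _⊖_

_⊛_ : FPS → FPS → FPS
(f ⊛ g) n = sumUpTo n (λ k → f k * g (n ∸ k))
infixl 7 _⊛_

𝟙 : FPS
𝟙 zero    = + 1
𝟙 (suc _) = + 0

𝕫 : FPS
𝕫 1 = + 1
𝕫 _ = + 0

_^ₛ_ : FPS → ℕ → FPS
f ^ₛ zero  = 𝟙
f ^ₛ suc k = f ⊛ (f ^ₛ k)

gf : (ℕ → ℕ) → FPS
gf a n = + a n

HasSize : Set → ℕ → Set
HasSize A N = Fin N ↔ A

-- up = (1,1);  down k = (1, -(k+1))   (so every down-step has size ≥ 1)
data DStep : Set where
  up   : DStep
  down : ℕ → DStep

dδ : DStep → ℤ
dδ up       = + 1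
dδ (down k) = - (+ suc k)

dLevelsFrom : ℤ → List DStep → List ℤ
dLevelsFrom y []       = y ∷ []
dLevelsFrom y (s ∷ ss) = y ∷ dLevelsFrom (y + dδ s) ss

dLevels : List DStep → List ℤ
dLevels = dLevelsFrom (+ 0)

OpenDeutsch : ℕ → Set
OpenDeutsch n = Σ (List DStep) λ p → length p ≡ n × All (λ y → + 0 ≤ y) (dLevels p)

BoundedOpenDeutsch : ℕ → ℕ → Set
BoundedOpenDeutsch h n =
  Σ (List DStep) λ p → length p ≡ n × All (λ y → (+ 0 ≤ y) × (y ≤ + h)) (dLevels p)

data MStep : Set where
  U F D : MStep

mδ : MStep → ℤ
mδ U = + 1
mδ F = + 0
mδ D = - (+ 1)

mLevelsFrom : ℤ → List MStep → List ℤ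
mLevelsFrom y []       = y ∷ []
mLevelsFrom y (s ∷ ss) = y ∷ mLevelsFrom (y + mδ s) ss

mFinal : ℤ → List MStep → ℤ
mFinal y []       = y
mFinal y (s ∷ ss) = mFinal (y + mδ s) ss

Motzkin : ℕ → Set
Motzkin n = Σ (List MStep) λ p →
  length p ≡ n × All (λ y → + 0 ≤ y) (mLevelsFrom (+ 0) p) × mFinal (+ 0) p ≡ + 0

module Submission where

-- Let v satisfy  v = z (1 + v + v²).  Every family of paths is counted by a
-- first-return decomposition: a nonempty path begins with an up-step (for
-- Motzkin paths possibly a flat step) and afterwards either never comes back
-- to level 0, being then a shifted path of a lower region, or returns to 0 by
-- one down-step and goes on from there.  This gives, for the generating
-- functions G_h of the strips 0 ≤ y ≤ h,
--   G_0 = 1,   G_{h+1} = 1 + z G_h + z² G_h G_{h+1},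
-- and X = 1 + zX + z²X² for open Deutsch paths and for Motzkin paths alike.
-- In the ring of formal power series, induction on h then yields the strip
-- formula, and the quadratic equation has the single solution 1 + v + v², so
-- both counting sequences equal its coefficients.  Each algebraic step is a
-- polynomial identity (ring solver) followed by cancelling a series with
-- constant term 1.

open import Defs
open import Data.Nat as ℕ using (ℕ; zero; suc; _∸_; z≤n; s≤s)
import Data.Nat.Properties as ℕₚ
open import Data.Integer as ℤ using (ℤ; +_; +0)
import Data.Integer.Properties as ℤₚ
open import Data.Product using (Σ; _×_; _,_; proj₁; proj₂)
open import Function using (_∘_)
open import Relation.Binary.PropositionalEquality

module FiniteSums where
  open import Data.Integer using (_+_; _*_)
  open import Algebra.Properties.CommutativeSemigroup ℤₚ.+-commutativeSemigroup
    using (interchange)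
  open ≡-Reasoning

  sum-cong : ∀ n {f g : ℕ → ℤ} → (∀ k → k ℕ.≤ n → f k ≡ g k) →
             sumUpTo n f ≡ sumUpTo n g
  sum-cong zero    f≗g = f≗g 0 z≤n
  sum-cong (suc n) f≗g =
    cong₂ _+_ (sum-cong n (λ k k≤n → f≗g k (ℕₚ.m≤n⇒m≤1+n k≤n))) (f≗g (suc n) ℕₚ.≤-refl)

  sum-zero : ∀ n (f : ℕ → ℤ) → (∀ k → k ℕ.≤ n → f k ≡ +0) → sumUpTo n f ≡ +0
  sum-zero zero    f f≗0 = f≗0 0 z≤n
  sum-zero (suc n) f f≗0 =
    cong₂ _+_ (sum-zero n f (λ k k≤n → f≗0 k (ℕₚ.m≤n⇒m≤1+n k≤n))) (f≗0 (suc n) ℕₚ.≤-refl)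

  sum-+ : ∀ n (f g : ℕ → ℤ) → sumUpTo n (λ k → f k + g k) ≡ sumUpTo n f + sumUpTo n g
  sum-+ zero    f g = refl
  sum-+ (suc n) f g = trans (cong (_+ (f (suc n) + g (suc n))) (sum-+ n f g))
                            (interchange (sumUpTo n f) (sumUpTo n g) (f (suc n)) (g (suc n)))

  sum-*ˡ : ∀ n c (f : ℕ → ℤ) → sumUpTo n (λ k → c * f k) ≡ c * sumUpTo n f
  sum-*ˡ zero    c f = refl
  sum-*ˡ (suc n) c f = trans (cong (_+ c * f (suc n)) (sum-*ˡ n c f))
                             (sym (ℤₚ.*-distribˡ-+ c (sumUpTo n f) (f (suc n))))

  sum-*ʳ : ∀ n c (f : ℕ → ℤ) → sumUpTo n (λ k → f k * c) ≡ sumUpTo n f * c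
  sum-*ʳ n c f = begin
    sumUpTo n (λ k → f k * c) ≡⟨ sum-cong n (λ k _ → ℤₚ.*-comm (f k) c) ⟩
    sumUpTo n (λ k → c * f k) ≡⟨ sum-*ˡ n c f ⟩
    c * sumUpTo n f           ≡⟨ ℤₚ.*-comm c _ ⟩
    sumUpTo n f * c           ∎

  sum-first : ∀ n (f : ℕ → ℤ) → sumUpTo (suc n) f ≡ f 0 + sumUpTo n (f ∘ suc)
  sum-first zero    f = refl
  sum-first (suc n) f = begin
    sumUpTo (suc n) f + f (suc (suc n))
      ≡⟨ cong (_+ f (suc (suc n))) (sum-first n f) ⟩
    (f 0 + sumUpTo n (f ∘ suc)) + f (suc (suc n))
      ≡⟨ ℤₚ.+-assoc (f 0) _ _ ⟩
    f 0 + sumUpTo (suc n) (f ∘ suc) ∎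

  sum-reverse : ∀ n (f : ℕ → ℤ) → sumUpTo n f ≡ sumUpTo n (λ k → f (n ∸ k))
  sum-reverse zero    f = refl
  sum-reverse (suc n) f = begin
    sumUpTo n f + f (suc n)                   ≡⟨ ℤₚ.+-comm (sumUpTo n f) _ ⟩
    f (suc n) + sumUpTo n f                   ≡⟨ cong (λ s → f (suc n) + s) (sum-reverse n f) ⟩
    f (suc n) + sumUpTo n (λ k → f (n ∸ k))   ≡⟨ sum-first n (λ k → f (suc n ∸ k)) ⟨
    sumUpTo (suc n) (λ k → f (suc n ∸ k))     ∎

  sum-triangle : ∀ n (Φ : ℕ → ℕ → ℤ) →
    sumUpTo n (λ k → sumUpTo k (λ i → Φ i k)) ≡
    sumUpTo n (λ i → sumUpTo (n ∸ i) (λ j → Φ i (i ℕ.+ j)))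
  sum-triangle zero    Φ = refl
  sum-triangle (suc n) Φ = begin
    sumUpTo n (λ k → sumUpTo k (λ i → Φ i k)) + (column n + Φ (suc n) (suc n))
      ≡⟨ cong (λ s → s + (column n + Φ (suc n) (suc n))) (sum-triangle n Φ) ⟩
    rows n n + (column n + Φ (suc n) (suc n))
      ≡⟨ ℤₚ.+-assoc (rows n n) _ _ ⟨
    (rows n n + column n) + Φ (suc n) (suc n)
      ≡⟨ cong (_+ Φ (suc n) (suc n)) (sum-+ n _ _) ⟨
    sumUpTo n (λ i → row n i + Φ i (suc n)) + Φ (suc n) (suc n)
      ≡⟨ cong₂ _+_ (sum-cong n extend-row) (cong (Φ (suc n)) (ℕₚ.+-identityʳ (suc n))) ⟨
    rows (suc n) n + Φ (suc n) (suc n ℕ.+ 0)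
      ≡⟨ cong (λ m → rows (suc n) n + sumUpTo m (λ j → Φ (suc n) (suc n ℕ.+ j))) (ℕₚ.n∸n≡0 n) ⟨
    rows (suc n) (suc n) ∎
    where
    row : ℕ → ℕ → ℤ
    row m i = sumUpTo (m ∸ i) (λ j → Φ i (i ℕ.+ j))
    rows : ℕ → ℕ → ℤ
    rows m l = sumUpTo l (row m)
    column : ℕ → ℤ
    column n = sumUpTo n (λ i → Φ i (suc n))
    extend-row : ∀ i → i ℕ.≤ n → row (suc n) i ≡ row n i + Φ i (suc n)
    extend-row i i≤n rewrite ℕₚ.+-∸-assoc 1 i≤n =
      cong (λ m → row n i + Φ i m) (trans (ℕₚ.+-suc i (n ∸ i)) (cong suc (ℕₚ.m+[n∸m]≡n i≤n)))

-- To use the ring solver the coefficientwise equality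
-- is wrapped in a record (so that it is not unfolded during unification).
module SeriesRing where
  open import Data.Integer using (_+_; _*_; -_)
  open import Algebra.Bundles using (CommutativeRing)
  open FiniteSums
  open ≡-Reasoning

  const : ℤ → FPS
  const a zero    = a
  const a (suc n) = +0

  0ₛ : FPS
  0ₛ = const +0

  0ₛ-coeff : ∀ n → 0ₛ n ≡ +0
  0ₛ-coeff zero    = refl
  0ₛ-coeff (suc n) = refl

  negₛ : FPS → FPS
  negₛ f n = - f n

  ⊛-cong : ∀ {f f′ g g′} → f ≈ₛ f′ → g ≈ₛ g′ → f ⊛ g ≈ₛ f′ ⊛ g′
  ⊛-cong f≈f′ g≈g′ n = sum-cong n (λ k _ → cong₂ _*_ (f≈f′ k) (g≈g′ (n ∸ k)))

  -- commutativity of ⊛, by summing in reverse order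
  ⊛-comm : ∀ f g → f ⊛ g ≈ₛ g ⊛ f
  ⊛-comm f g n = begin
    sumUpTo n (λ k → f k * g (n ∸ k))             ≡⟨ sum-reverse n _ ⟩
    sumUpTo n (λ k → f (n ∸ k) * g (n ∸ (n ∸ k))) ≡⟨ sum-cong n swap ⟩
    sumUpTo n (λ k → g k * f (n ∸ k))             ∎
    where
    swap : ∀ k → k ℕ.≤ n → f (n ∸ k) * g (n ∸ (n ∸ k)) ≡ g k * f (n ∸ k)
    swap k k≤n = trans (cong (λ i → f (n ∸ k) * g i) (ℕₚ.m∸[m∸n]≡n k≤n))
                       (ℤₚ.*-comm (f (n ∸ k)) (g k))

  ⊛-distribˡ : ∀ f g h → f ⊛ (g ⊕ h) ≈ₛ f ⊛ g ⊕ f ⊛ h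
  ⊛-distribˡ f g h n =
    trans (sum-cong n (λ k _ → ℤₚ.*-distribˡ-+ (f k) _ _)) (sum-+ n _ _)

  ⊛-distribʳ : ∀ f g h → (g ⊕ h) ⊛ f ≈ₛ g ⊛ f ⊕ h ⊛ f
  ⊛-distribʳ f g h n =
    trans (sum-cong n (λ k _ → ℤₚ.*-distribʳ-+ (f (n ∸ k)) (g k) _)) (sum-+ n _ _)

  ⊛-identityˡ : ∀ f → 𝟙 ⊛ f ≈ₛ f
  ⊛-identityˡ f zero    = ℤₚ.*-identityˡ (f 0)
  ⊛-identityˡ f (suc n) = begin
    sumUpTo (suc n) (λ k → 𝟙 k * f (suc n ∸ k)) ≡⟨ sum-first n _ ⟩
    + 1 * f (suc n) + sumUpTo n (λ _ → +0)
      ≡⟨ cong₂ _+_ (ℤₚ.*-identityˡ (f (suc n))) (sum-zero n _ (λ _ _ → refl)) ⟩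
    f (suc n) + +0                               ≡⟨ ℤₚ.+-identityʳ _ ⟩
    f (suc n)                                    ∎

  ⊛-identityʳ : ∀ f → f ⊛ 𝟙 ≈ₛ f
  ⊛-identityʳ f n = trans (⊛-comm f 𝟙 n) (⊛-identityˡ f n)

  -- associativity of ⊛: both sides are the sum of f i g j h l over i + j + l = n
  ⊛-assoc : ∀ f g h → (f ⊛ g) ⊛ h ≈ₛ f ⊛ (g ⊛ h)
  ⊛-assoc f g h n = begin
    sumUpTo n (λ k → sumUpTo k (λ i → f i * g (k ∸ i)) * h (n ∸ k))
      ≡⟨ sum-cong n (λ k _ → sym (sum-*ʳ k (h (n ∸ k)) _)) ⟩
    sumUpTo n (λ k → sumUpTo k (λ i → f i * g (k ∸ i) * h (n ∸ k)))
      ≡⟨ sum-triangle n (λ i k → f i * g (k ∸ i) * h (n ∸ k)) ⟩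
    sumUpTo n (λ i → sumUpTo (n ∸ i) (λ j → f i * g (i ℕ.+ j ∸ i) * h (n ∸ (i ℕ.+ j))))
      ≡⟨ sum-cong n (λ i _ → sum-cong (n ∸ i) (λ j _ → reindex i j)) ⟩
    sumUpTo n (λ i → sumUpTo (n ∸ i) (λ j → f i * (g j * h (n ∸ i ∸ j))))
      ≡⟨ sum-cong n (λ i _ → sum-*ˡ (n ∸ i) (f i) _) ⟩
    sumUpTo n (λ i → f i * sumUpTo (n ∸ i) (λ j → g j * h (n ∸ i ∸ j))) ∎
    where
    reindex : ∀ i j → f i * g (i ℕ.+ j ∸ i) * h (n ∸ (i ℕ.+ j)) ≡ f i * (g j * h (n ∸ i ∸ j))
    reindex i j = trans (cong₂ (λ a b → f i * g a * h b) (ℕₚ.m+n∸m≡n i j) (sym (ℕₚ.∸-+-assoc n i j)))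
                        (ℤₚ.*-assoc (f i) _ _)

  record _≋_ (f g : FPS) : Set where
    constructor coeffwise
    field coeff : f ≈ₛ g
  open _≋_ public
  infix 4 _≋_

  seriesRing : CommutativeRing _ _
  seriesRing = record
    { Carrier = FPS
    ; _≈_ = _≋_
    ; _+_ = _⊕_
    ; _*_ = _⊛_
    ; -_ = negₛ
    ; 0# = 0ₛ
    ; 1# = 𝟙
    ; isCommutativeRing = record
      { isRing = record
        { +-isAbelianGroup = record
          { isGroup = record
            { isMonoid = record
              { isSemigroup = record
                { isMagma = record
                  { isEquivalence = record
                    { refl  = coeffwise (λ _ → refl)
                    ; sym   = λ p → coeffwise (λ n → sym (coeff p n))
                    ; trans = λ p q → coeffwise (λ n → trans (coeff p n) (coeff q n)) }
                  ; ∙-cong = λ p q → coeffwise (λ n → cong₂ _+_ (coeff p n) (coeff q n)) }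
                ; assoc = λ f g h → coeffwise (λ n → ℤₚ.+-assoc (f n) (g n) (h n)) }
              ; identity =
                  (λ f → coeffwise (λ n → trans (cong (_+ f n) (0ₛ-coeff n)) (ℤₚ.+-identityˡ (f n))))
                , (λ f → coeffwise (λ n → trans (cong (λ x → f n + x) (0ₛ-coeff n)) (ℤₚ.+-identityʳ (f n)))) }
            ; inverse =
                (λ f → coeffwise (λ n → trans (ℤₚ.+-inverseˡ (f n)) (sym (0ₛ-coeff n))))
              , (λ f → coeffwise (λ n → trans (ℤₚ.+-inverseʳ (f n)) (sym (0ₛ-coeff n))))
            ; ⁻¹-cong = λ p → coeffwise (λ n → cong -_ (coeff p n)) }
          ; comm = λ f g → coeffwise (λ n → ℤₚ.+-comm (f n) (g n)) }
        ; *-cong = λ p q → coeffwise (⊛-cong (coeff p) (coeff q))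
        ; *-assoc = λ f g h → coeffwise (⊛-assoc f g h)
        ; *-identity = (λ f → coeffwise (⊛-identityˡ f)) , (λ f → coeffwise (⊛-identityʳ f))
        ; distrib = (λ f g h → coeffwise (⊛-distribˡ f g h)) , (λ f g h → coeffwise (⊛-distribʳ f g h)) }
      ; *-comm = λ f g → coeffwise (⊛-comm f g) }
    }

module SeriesSolver where
  open import Data.Integer using (_*_)
  open import Algebra.Bundles using (CommutativeRing)
  open import Algebra.Solver.Ring.AlmostCommutativeRing
  open import Data.Maybe using (Maybe; just; nothing)
  open import Relation.Nullary using (yes; no)
  open FiniteSums using (sum-zero)
  open SeriesRing

  const-* : ∀ a b → const (a * b) ≋ const a ⊛ const b
  const-* a b = coeffwise λ
    { zero    → refl
    ; (suc n) → sym (sum-zero (suc n) _ λ { zero _ → ℤₚ.*-zeroʳ a ; (suc k) _ → refl }) }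

  const-homomorphism : CommutativeRing.rawRing ℤₚ.+-*-commutativeRing
                         -Raw-AlmostCommutative⟶ fromCommutativeRing seriesRing
  const-homomorphism = record
    { ⟦_⟧    = const
    ; +-homo = λ a b → coeffwise λ { zero → refl ; (suc n) → refl }
    ; *-homo = const-*
    ; -‿homo = λ a → coeffwise λ { zero → refl ; (suc n) → refl }
    ; 0-homo = coeffwise λ { zero → refl ; (suc n) → refl }
    ; 1-homo = coeffwise λ { zero → refl ; (suc n) → refl }
    }

  -- equal integers give equal constant series (a semi-decision, as the solver needs)
  const-≟ : ∀ a b → Maybe (const a ≋ const b)
  const-≟ a b with a ℤ.≟ b
  ... | yes refl = just (coeffwise λ _ → refl)
  ... | no _     = nothing

  open import Algebra.Solver.Ring (CommutativeRing.rawRing ℤₚ.+-*-commutativeRing)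
    (fromCommutativeRing seriesRing) const-homomorphism const-≟ public

module UnitCancellation where
  open import Data.Integer using (_+_; _*_)
  open import Data.Nat.Induction using (<-rec)
  open FiniteSums
  open SeriesRing using (0ₛ; 0ₛ-coeff)
  open ≡-Reasoning

  leading-coeff : ∀ (f u : FPS) n → (∀ {k} → k ℕ.< n → f k ≡ +0) → (f ⊛ u) n ≡ f n * u 0
  leading-coeff f u zero    below = refl
  leading-coeff f u (suc n) below = begin
    sumUpTo n (λ k → f k * u (suc n ∸ k)) + f (suc n) * u (suc n ∸ suc n)
      ≡⟨ cong₂ _+_ (sum-zero n _ (λ k k≤n → cong (_* u (suc n ∸ k)) (below (s≤s k≤n))))
                   (cong (λ i → f (suc n) * u i) (ℕₚ.n∸n≡0 n)) ⟩
    +0 + f (suc n) * u 0 ≡⟨ ℤₚ.+-identityˡ _ ⟩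
    f (suc n) * u 0      ∎

  unit-not-zero-divisor : ∀ (f u : FPS) → u 0 ≡ + 1 → f ⊛ u ≈ₛ 0ₛ → f ≈ₛ 0ₛ
  unit-not-zero-divisor f u u₀≡1 fu≈0 n =
    trans (<-rec (λ n → f n ≡ +0) vanish n) (sym (0ₛ-coeff n))
    where
    vanish : ∀ n → (∀ {k} → k ℕ.< n → f k ≡ +0) → f n ≡ +0
    vanish n below = begin
      f n            ≡⟨ ℤₚ.*-identityʳ (f n) ⟨
      f n * + 1      ≡⟨ cong (f n *_) u₀≡1 ⟨
      f n * u 0      ≡⟨ leading-coeff f u n below ⟨
      (f ⊛ u) n      ≡⟨ fu≈0 n ⟩
      0ₛ n           ≡⟨ 0ₛ-coeff n ⟩
      +0             ∎

-- Each is a polynomial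
-- identity (checked by the ring solver) expressing the goal as a
-- combination of the hypotheses, followed by cancellation of a unit.
module SeriesAlgebra where
  open SeriesRing
  open SeriesSolver
  open UnitCancellation using (unit-not-zero-divisor)
  open import Algebra.Bundles using (CommutativeRing)
  module R = CommutativeRing seriesRing
  open R using (_+_; _*_; _-_; _≈_; 0#; 1#)
  open import Algebra.Properties.Group R.+-group using (x∙y⁻¹≈ε⇒x≈y; x≈y⇒x∙y⁻¹≈ε)
  open import Relation.Binary.Reasoning.Setoid R.setoid

  motzkinForm : FPS → FPS
  motzkinForm v = 𝟙 ⊕ v ⊕ v ^ₛ 2

  cancel : ∀ u {a b} → u 0 ≡ + 1 → a * u ≈ b * u → a ≈ b
  cancel u {a} {b} u₀≡1 au≈bu =
    x∙y⁻¹≈ε⇒x≈y a b (coeffwise (unit-not-zero-divisor (a - b) u u₀≡1 (coeff (begin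
      (a - b) * u   ≈⟨ solve 3 (λ a b u → (a :- b) :* u := a :* u :- b :* u) R.refl a b u ⟩
      a * u - b * u ≈⟨ x≈y⇒x∙y⁻¹≈ε au≈bu ⟩
      0#            ∎))))

  -- each hypothesis  a ≈ b  contributes a vanishing term  k (a - b)
  scaled-difference : ∀ k {a b} → a ≈ b → k * (a - b) ≈ 0#
  scaled-difference k {a} {b} a≈b = R.trans (R.*-congˡ {k} (x≈y⇒x∙y⁻¹≈ε {a} {b} a≈b)) (R.zeroʳ k)

  vanishing₂ : ∀ {a b} → a ≈ 0# → b ≈ 0# → a - b ≈ 0#
  vanishing₂ a≈0 b≈0 =
    R.trans (R.+-cong a≈0 (R.-‿cong b≈0)) (solve 0 (con +0 :- con +0 := con +0) R.refl)

  vanishing₃ : ∀ {a b c} → a ≈ 0# → b ≈ 0# → c ≈ 0# → a + b - c ≈ 0#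
  vanishing₃ a≈0 b≈0 c≈0 =
    R.trans (R.+-cong (R.+-cong a≈0 b≈0) (R.-‿cong c≈0))
            (solve 0 (con +0 :+ con +0 :- con +0 := con +0) R.refl)

  -- the polynomial identity behind strip-step: (1 + v) times the goal difference is a
  -- combination of the differences of the three hypotheses
  strip-identity : ∀ G P z v Y →
    G * (1# - v * (v * (v * Y))) * (1# + v) - motzkinForm v * (1# - v * Y) * (1# + v)
    ≈ motzkinForm v * (1# - v * (v * Y)) * (G - (1# + z * P + z * z * P * G))
    + (G * z * z * motzkinForm v + motzkinForm v * z)
        * (P * (1# - v * (v * Y)) - motzkinForm v * (1# - Y))
    - (G * (v + z * motzkinForm v) * (1# - Y) + motzkinForm v * (1# - Y))
        * (v - z * motzkinForm v)
  strip-identity = solve 5 (λ G P z v Y → let o = v :^ 0 ; c = o :+ v :+ v :* (v :* o) in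
    G :* (o :- v :* (v :* (v :* Y))) :* (o :+ v) :- c :* (o :- v :* Y) :* (o :+ v)
    := c :* (o :- v :* (v :* Y)) :* (G :- (o :+ z :* P :+ z :* z :* P :* G))
    :+ (G :* z :* z :* c :+ c :* z) :* (P :* (o :- v :* (v :* Y)) :- c :* (o :- Y))
    :- (G :* (v :+ z :* c) :* (o :- Y) :+ c :* (o :- Y)) :* (v :- z :* c)) R.refl

  strip-step : ∀ G P z v Y → v 0 ≡ +0 → v ≈ z * motzkinForm v →
    G ≈ 1# + z * P + z * z * P * G →
    P * (1# - v * (v * Y)) ≈ motzkinForm v * (1# - Y) →
    G * (1# - v * (v * (v * Y))) ≈ motzkinForm v * (1# - v * Y)
  strip-step G P z v Y v₀≡0 v≈zc G-rec P-strip =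
    cancel (1# + v) (cong (λ a → + 1 ℤ.+ a) v₀≡0)
      (x∙y⁻¹≈ε⇒x≈y (G * (1# - v * (v * (v * Y))) * (1# + v)) (motzkinForm v * (1# - v * Y) * (1# + v))
      (R.trans (strip-identity G P z v Y)
               (vanishing₃ (scaled-difference k₁ G-rec) (scaled-difference k₂ P-strip)
                           (scaled-difference k₃ v≈zc))))
    where
    c k₁ k₂ k₃ : FPS
    c  = motzkinForm v
    k₁ = c * (1# - v * (v * Y))
    k₂ = G * z * z * c + c * z
    k₃ = G * (v + z * c) * (1# - Y) + c * (1# - Y)

  -- the identity behind quadratic-solution: u times the goal difference, for the unit
  -- u = 1 - z - z²(X + c), is a combination of the differences of the hypotheses
  quadratic-identity : ∀ X z v →
    X * (1# - z - z * z * (X + motzkinForm v)) - motzkinForm v * (1# - z - z * z * (X + motzkinForm v))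
    ≈ (X - (1# + z * X + z * z * X * X)) - (1# + v + z * motzkinForm v) * (v - z * motzkinForm v)
  quadratic-identity = solve 3 (λ X z v → let o = v :^ 0 ; c = o :+ v :+ v :* (v :* o) in
    X :* (o :- z :- z :* z :* (X :+ c)) :- c :* (o :- z :- z :* z :* (X :+ c))
    := (X :- (o :+ z :* X :+ z :* z :* X :* X)) :- (o :+ v :+ z :* c) :* (v :- z :* c)) R.refl

  quadratic-solution : ∀ X z v → z 0 ≡ +0 → v ≈ z * motzkinForm v →
    X ≈ 1# + z * X + z * z * X * X → X ≈ motzkinForm v
  quadratic-solution X z v z₀≡0 v≈zc X-rec =
    cancel u u₀≡1 (x∙y⁻¹≈ε⇒x≈y (X * u) (motzkinForm v * u)
      (R.trans (quadratic-identity X z v)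
               (vanishing₂ (x≈y⇒x∙y⁻¹≈ε {X} X-rec) (scaled-difference (1# + v + z * motzkinForm v) v≈zc))))
    where
    u : FPS
    u = 1# - z - z * z * (X + motzkinForm v)
    u₀≡1 : u 0 ≡ + 1
    u₀≡1 rewrite z₀≡0 = refl

-- The one structural
-- decomposition used for paths is a first-return recursion
--   A 0 ≅ 1,   A (m+1) ≅ X m ⊎ (Y ⋆ A) m,
-- where (Y ⋆ A) m is the set of pairs (y, a) with |y| + |a| + 1 = m.
module Counting where
  open import Data.Nat using (_≤_; _<_; _+_; _*_)
  open import Data.Nat.Induction using (<-rec)
  open import Data.Fin.Properties using (0↔⊥; 1↔⊤; +↔⊎; *↔×)
  open import Data.Fin.Permutation using (↔⇒≡)
  open import Data.Sum using (_⊎_; inj₁; inj₂)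
  open import Data.Unit using (⊤)
  open import Data.Empty using (⊥; ⊥-elim)
  open import Function.Bundles using (_↔_; mk↔ₛ′)
  open import Function.Properties.Inverse using (↔-trans; ↔-sym)
  open import Data.Sum.Function.Propositional using (_⊎-↔_)
  open import Data.Product.Function.NonDependent.Propositional using (_×-↔_)
  open import Relation.Nullary using (Dec; yes; no)

  Sized : Set → Set
  Sized A = Σ ℕ (HasSize A)

  size-unique : ∀ {A m n} → HasSize A m → HasSize A n → m ≡ n
  size-unique p q = ↔⇒≡ (↔-trans p (↔-sym q))

  size-↔ : ∀ {A B n} → HasSize A n → A ↔ B → HasSize B n
  size-↔ = ↔-trans

  size-⊎ : ∀ {A B a b} → HasSize A a → HasSize B b → HasSize (A ⊎ B) (a + b)
  size-⊎ p q = ↔-trans +↔⊎ (p ⊎-↔ q)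

  size-× : ∀ {A B a b} → HasSize A a → HasSize B b → HasSize (A × B) (a * b)
  size-× p q = ↔-trans *↔× (p ×-↔ q)

  sumℕ : ℕ → (ℕ → ℕ) → ℕ
  sumℕ zero    f = f 0
  sumℕ (suc n) f = sumℕ n f + f (suc n)

  UpTo : ℕ → (ℕ → Set) → Set
  UpTo n P = Σ ℕ λ k → k ≤ n × P k

  upTo-zero : ∀ P → UpTo 0 P ↔ P 0
  upTo-zero P = mk↔ₛ′ (λ { (.0 , z≤n , x) → x }) (λ x → 0 , z≤n , x)
                      (λ _ → refl) (λ { (.0 , z≤n , x) → refl })

  upTo-suc : ∀ n P → UpTo (suc n) P ↔ (UpTo n P ⊎ P (suc n))
  upTo-suc n P = mk↔ₛ′ to from to∘from from∘to
    where
    to : UpTo (suc n) P → UpTo n P ⊎ P (suc n)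
    to (k , k≤1+n , x) with k ℕ.≤? n
    ... | yes k≤n = inj₁ (k , k≤n , x)
    ... | no  k≰n = inj₂ (subst P (ℕₚ.≤-antisym k≤1+n (ℕₚ.≰⇒> k≰n)) x)
    from : UpTo n P ⊎ P (suc n) → UpTo (suc n) P
    from (inj₁ (k , k≤n , x)) = k , ℕₚ.m≤n⇒m≤1+n k≤n , x
    from (inj₂ x)             = suc n , ℕₚ.≤-refl , x
    to∘from : ∀ y → to (from y) ≡ y
    to∘from (inj₁ (k , k≤n , x)) with k ℕ.≤? n
    ... | yes k≤n′ = cong (λ p → inj₁ (k , p , x)) (ℕₚ.≤-irrelevant k≤n′ k≤n)
    ... | no  k≰n  = ⊥-elim (k≰n k≤n)
    to∘from (inj₂ x) with suc n ℕ.≤? n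
    ... | yes 1+n≤n = ⊥-elim (ℕₚ.<-irrefl refl 1+n≤n)
    ... | no  1+n≰n with ℕₚ.≤-antisym (ℕₚ.≤-refl {suc n}) (ℕₚ.≰⇒> 1+n≰n)
    ...   | refl = refl
    from∘to : ∀ y → from (to y) ≡ y
    from∘to (k , k≤1+n , x) with k ℕ.≤? n
    ... | yes k≤n = cong (λ p → k , p , x) (ℕₚ.≤-irrelevant _ _)
    ... | no  k≰n with ℕₚ.≤-antisym k≤1+n (ℕₚ.≰⇒> k≰n)
    ...   | refl = cong (λ p → suc n , p , x) (ℕₚ.≤-irrelevant _ _)

  size-upTo : ∀ n P (f : ℕ → ℕ) → (∀ k → k ≤ n → HasSize (P k) (f k)) →
              HasSize (UpTo n P) (sumℕ n f)
  size-upTo zero    P f sizes = size-↔ (sizes 0 z≤n) (↔-sym (upTo-zero P))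
  size-upTo (suc n) P f sizes =
    size-↔ (size-⊎ (size-upTo n P f (λ k k≤n → sizes k (ℕₚ.m≤n⇒m≤1+n k≤n)))
                   (sizes (suc n) ℕₚ.≤-refl))
           (↔-sym (upTo-suc n P))

  _⋆_ : (ℕ → Set) → (ℕ → Set) → ℕ → Set
  (X ⋆ Y) m = Σ ℕ λ k → Σ ℕ λ l → suc (k + l) ≡ m × X k × Y l

  ⋆-zero : ∀ X Y → (X ⋆ Y) 0 ↔ ⊥
  ⋆-zero X Y = mk↔ₛ′ (λ { (_ , _ , () , _) }) (λ ()) (λ ()) (λ { (_ , _ , () , _) })

  ⋆-suc : ∀ X Y n → (X ⋆ Y) (suc n) ↔ UpTo n (λ k → X k × Y (n ∸ k))
  ⋆-suc X Y n = mk↔ₛ′ to from to∘from from∘to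
    where
    second : ∀ k l → suc (k + l) ≡ suc n → l ≡ n ∸ k
    second k l e = sym (trans (cong (_∸ k) (sym (ℕₚ.suc-injective e))) (ℕₚ.m+n∸m≡n k l))
    first≤ : ∀ k l → suc (k + l) ≡ suc n → k ≤ n
    first≤ k l e = subst (k ≤_) (ℕₚ.suc-injective e) (ℕₚ.m≤m+n k l)
    to : (X ⋆ Y) (suc n) → UpTo n (λ k → X k × Y (n ∸ k))
    to (k , l , e , x , y) = k , first≤ k l e , x , subst Y (second k l e) y
    from : UpTo n (λ k → X k × Y (n ∸ k)) → (X ⋆ Y) (suc n)
    from (k , k≤n , x , y) = k , n ∸ k , cong suc (ℕₚ.m+[n∸m]≡n k≤n) , x , y
    to∘from : ∀ p → to (from p) ≡ p
    to∘from (k , k≤n , x , y)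
      rewrite ℕₚ.≡-irrelevant (second k (n ∸ k) (cong suc (ℕₚ.m+[n∸m]≡n k≤n))) refl
      = cong (λ p → k , p , x , y) (ℕₚ.≤-irrelevant _ _)
    transport : ∀ k x {l l′} (q : l ≡ l′) e e′ (y : Y l) →
      _≡_ {A = (X ⋆ Y) (suc n)} (k , l′ , e′ , x , subst Y q y) (k , l , e , x , y)
    transport k x refl e e′ y = cong (λ p → k , _ , p , x , y) (ℕₚ.≡-irrelevant _ _)
    from∘to : ∀ p → from (to p) ≡ p
    from∘to (k , l , e , x , y) = transport k x (second k l e) e _ y

  _⋆ℕ_ : (ℕ → ℕ) → (ℕ → ℕ) → ℕ → ℕ
  (x ⋆ℕ y) zero    = 0
  (x ⋆ℕ y) (suc n) = sumℕ n (λ k → x k * y (n ∸ k))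

  size-⋆ : ∀ X Y (x y : ℕ → ℕ) m →
    (∀ k → k < m → HasSize (X k) (x k)) → (∀ k → k < m → HasSize (Y k) (y k)) →
    HasSize ((X ⋆ Y) m) ((x ⋆ℕ y) m)
  size-⋆ X Y x y zero    _  _  = size-↔ 0↔⊥ (↔-sym (⋆-zero X Y))
  size-⋆ X Y x y (suc n) sX sY =
    size-↔ (size-upTo n _ _ (λ k k≤n → size-× (sX k (s≤s k≤n)) (sY (n ∸ k) (s≤s (ℕₚ.m∸n≤m n k)))))
           (↔-sym (⋆-suc X Y n))

  sizes-below : ∀ m (P : ℕ → Set) → (∀ k → k < m → Sized (P k)) →
                Σ (ℕ → ℕ) λ f → ∀ k → k < m → HasSize (P k) (f k)
  sizes-below m P sized = (λ k → pick k (k ℕ.<? m)) , (λ k k<m → pick-size k (k ℕ.<? m) k<m)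
    where
    pick : ∀ k → Dec (k < m) → ℕ
    pick k (yes k<m) = proj₁ (sized k k<m)
    pick k (no  _)   = 0
    pick-size : ∀ k d → k < m → HasSize (P k) (pick k d)
    pick-size k (yes k<m) _   = proj₂ (sized k k<m)
    pick-size k (no  k≮m) k<m = ⊥-elim (k≮m k<m)

  record FirstReturn (A X Y : ℕ → Set) : Set where
    field
      empty : A 0 ↔ ⊤
      step  : ∀ m → A (suc m) ↔ (X m ⊎ (Y ⋆ A) m)

  module _ {A X Y : ℕ → Set} (R : FirstReturn A X Y) where
    open FirstReturn R

    size-recurrence : (a x y : ℕ → ℕ) →
      (∀ k → HasSize (A k) (a k)) → (∀ k → HasSize (X k) (x k)) → (∀ k → HasSize (Y k) (y k)) →
      (a 0 ≡ 1) × (∀ m → a (suc m) ≡ x m + (y ⋆ℕ a) m)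
    size-recurrence a x y sA sX sY =
        size-unique (sA 0) (↔-sym (↔-trans empty (↔-sym 1↔⊤)))
      , λ m → size-unique (sA (suc m))
                (size-↔ (size-⊎ (sX m) (size-⋆ Y A y a m (λ k _ → sY k) (λ k _ → sA k)))
                        (↔-sym (step m)))

    sized-family : (∀ m → Sized (X m)) → (∀ m → Sized (Y m)) → ∀ n → Sized (A n)
    sized-family sX sY = <-rec (λ n → Sized (A n)) sized
      where
      sized : ∀ n → (∀ {k} → k < n → Sized (A k)) → Sized (A n)
      sized zero    _     = 1 , ↔-sym (↔-trans empty (↔-sym 1↔⊤))
      sized (suc m) below =
        let a , sA = sizes-below m A (λ k k<m → below (ℕₚ.m<n⇒m<1+n k<m))
            y , sY′ = sizes-below m Y (λ k _ → sY k)
        in _ , size-↔ (size-⊎ (proj₂ (sX m)) (size-⋆ Y A y a m sY′ sA)) (↔-sym (step m))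

module GeneratingFunctions where
  open import Data.Integer using (_+_; _*_)
  open FiniteSums
  open Counting using (sumℕ; _⋆ℕ_; FirstReturn; size-recurrence)
  open SeriesRing using (_≋_; coeffwise; seriesRing)
  open import Function.Bundles using (_↔_)
  open import Function.Properties.Inverse using (↔-trans)
  open import Algebra.Bundles using (CommutativeRing)
  module R = CommutativeRing seriesRing
  open ≡-Reasoning

  z-shift : ∀ f n → (𝕫 ⊛ f) (suc n) ≡ f n
  z-shift f n = begin
    sumUpTo (suc n) (λ k → 𝕫 k * f (suc n ∸ k))   ≡⟨ sum-first n _ ⟩
    +0 + sumUpTo n (λ k → 𝕫 (suc k) * f (n ∸ k))  ≡⟨ ℤₚ.+-identityˡ _ ⟩
    sumUpTo n (λ k → 𝕫 (suc k) * f (n ∸ k))       ≡⟨ only-first n ⟩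
    f n                                           ∎
    where
    only-first : ∀ n → sumUpTo n (λ k → 𝕫 (suc k) * f (n ∸ k)) ≡ f n
    only-first zero    = ℤₚ.*-identityˡ (f 0)
    only-first (suc n) = begin
      sumUpTo (suc n) (λ k → 𝕫 (suc k) * f (suc n ∸ k))    ≡⟨ sum-first n _ ⟩
      + 1 * f (suc n) + sumUpTo n (λ _ → +0)
        ≡⟨ cong₂ _+_ (ℤₚ.*-identityˡ (f (suc n))) (sum-zero n _ (λ _ _ → refl)) ⟩
      f (suc n) + +0                                       ≡⟨ ℤₚ.+-identityʳ _ ⟩
      f (suc n)                                            ∎

  gf-sumℕ : ∀ n f → + sumℕ n f ≡ sumUpTo n (λ k → + f k)
  gf-sumℕ zero    f = refl
  gf-sumℕ (suc n) f = trans (ℤₚ.pos-+ (sumℕ n f) (f (suc n))) (cong (_+ + f (suc n)) (gf-sumℕ n f))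

  gf-⋆ℕ : ∀ y a n → gf (y ⋆ℕ a) (suc n) ≡ (gf y ⊛ gf a) n
  gf-⋆ℕ y a n = trans (gf-sumℕ n _) (sum-cong n (λ k _ → ℤₚ.pos-* (y k) (a (n ∸ k))))

  recurrence-series : ∀ (a x y : ℕ → ℕ) → a 0 ≡ 1 → (∀ m → a (suc m) ≡ x m ℕ.+ (y ⋆ℕ a) m) →
    gf a ≋ 𝟙 ⊕ 𝕫 ⊛ gf x ⊕ 𝕫 ⊛ 𝕫 ⊛ gf y ⊛ gf a
  recurrence-series a x y a₀ a-suc = R.trans (coeffwise coefficient) (R.+-congˡ {𝟙 ⊕ 𝕫 ⊛ gf x} (R.sym reassoc))
    where
    reassoc : 𝕫 ⊛ 𝕫 ⊛ gf y ⊛ gf a ≋ 𝕫 ⊛ (𝕫 ⊛ (gf y ⊛ gf a))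
    reassoc = R.trans (R.*-assoc (𝕫 ⊛ 𝕫) (gf y) (gf a)) (R.*-assoc 𝕫 𝕫 (gf y ⊛ gf a))
    coefficient : ∀ n → gf a n ≡ (𝟙 ⊕ 𝕫 ⊛ gf x ⊕ 𝕫 ⊛ (𝕫 ⊛ (gf y ⊛ gf a))) n
    coefficient zero = cong +_ a₀
    coefficient (suc zero) = begin
      + a 1                  ≡⟨ cong +_ (trans (a-suc 0) (ℕₚ.+-identityʳ (x 0))) ⟩
      + x 0                  ≡⟨ z-shift (gf x) 0 ⟨
      (𝕫 ⊛ gf x) 1           ≡⟨ ℤₚ.+-identityˡ _ ⟨
      +0 + (𝕫 ⊛ gf x) 1      ≡⟨ ℤₚ.+-identityʳ _ ⟨
      +0 + (𝕫 ⊛ gf x) 1 + +0 ≡⟨ cong (λ t → +0 + (𝕫 ⊛ gf x) 1 + t) (z-shift (𝕫 ⊛ (gf y ⊛ gf a)) 0) ⟨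
      (𝟙 ⊕ 𝕫 ⊛ gf x ⊕ 𝕫 ⊛ (𝕫 ⊛ (gf y ⊛ gf a))) 1 ∎
    coefficient (suc (suc n)) = begin
      + a (suc (suc n))                      ≡⟨ cong +_ (a-suc (suc n)) ⟩
      + (x (suc n) ℕ.+ (y ⋆ℕ a) (suc n))     ≡⟨ ℤₚ.pos-+ (x (suc n)) _ ⟩
      + x (suc n) + gf (y ⋆ℕ a) (suc n)      ≡⟨ cong₂ _+_ (sym (z-shift (gf x) (suc n))) (gf-⋆ℕ y a n) ⟩
      (𝕫 ⊛ gf x) (suc (suc n)) + (gf y ⊛ gf a) n
        ≡⟨ cong (λ t → (𝕫 ⊛ gf x) (suc (suc n)) + t)
                (trans (z-shift (𝕫 ⊛ (gf y ⊛ gf a)) (suc n)) (z-shift (gf y ⊛ gf a) n)) ⟨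
      (𝕫 ⊛ gf x) (suc (suc n)) + (𝕫 ⊛ (𝕫 ⊛ (gf y ⊛ gf a))) (suc (suc n))
        ≡⟨ cong (_+ (𝕫 ⊛ (𝕫 ⊛ (gf y ⊛ gf a))) (suc (suc n)))
                (ℤₚ.+-identityˡ ((𝕫 ⊛ gf x) (suc (suc n)))) ⟨
      (𝟙 ⊕ 𝕫 ⊛ gf x ⊕ 𝕫 ⊛ (𝕫 ⊛ (gf y ⊛ gf a))) (suc (suc n)) ∎

  first-return-series : ∀ {A X Y : ℕ → Set} → FirstReturn A X Y → (a x y : ℕ → ℕ) →
    (∀ k → HasSize (A k) (a k)) → (∀ k → HasSize (X k) (x k)) → (∀ k → HasSize (Y k) (y k)) →
    gf a ≋ 𝟙 ⊕ 𝕫 ⊛ gf x ⊕ 𝕫 ⊛ 𝕫 ⊛ gf y ⊛ gf a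
  first-return-series R a x y sA sX sY =
    let a₀ , a-suc = size-recurrence R a x y sA sX sY in recurrence-series a x y a₀ a-suc

  self-similar-series : ∀ {A X Y : ℕ → Set} → FirstReturn A X Y → (a : ℕ → ℕ) →
    (∀ k → HasSize (A k) (a k)) → (∀ k → A k ↔ X k) → (∀ k → A k ↔ Y k) →
    gf a ≋ 𝟙 ⊕ 𝕫 ⊛ gf a ⊕ 𝕫 ⊛ 𝕫 ⊛ gf a ⊛ gf a
  self-similar-series R a sA A↔X A↔Y =
    first-return-series R a a a sA (λ k → ↔-trans (sA k) (A↔X k)) (λ k → ↔-trans (sA k) (A↔Y k))

-- Paths as runs of a partial automaton on the levels ℕ: a step s taken at
-- level y leads to level  next y s,  or is forbidden (nothing).
module Automata where
  open import Data.Bool using (Bool; true; false; T)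
  open import Data.Maybe using (Maybe; just; nothing; maybe′; fromMaybe; _>>=_)
  open import Data.List using (List; []; _∷_; length; _++_)
  import Data.List.Properties as Listₚ
  open import Data.Sum using (_⊎_; inj₁; inj₂)
  open import Function.Bundles using (_↔_; mk↔ₛ′)
  open Counting using (_⋆_)

  Words : {S : Set} → (List S → Bool) → ℕ → Set
  Words {S} test n = Σ (List S) λ p → length p ≡ n × T (test p)

  -- proofs of T b are unique, so words are determined by their lists
  T-irrelevant : ∀ {b} (x y : T b) → x ≡ y
  T-irrelevant {true} _ _ = refl

  word-≡ : ∀ {S : Set} {test : List S → Bool} {n} {p p′ : List S} {l l′ t t′} → p ≡ p′ →
           _≡_ {A = Words test n} (p , l , t) (p′ , l′ , t′)
  word-≡ {l = l} {l′} {t} {t′} refl =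
    cong₂ (λ l t → _ , l , t) (ℕₚ.≡-irrelevant l l′) (T-irrelevant t t′)

  words-cong : ∀ {S : Set} {test test′ : List S → Bool} n →
               (∀ p → test p ≡ test′ p) → Words test n ↔ Words test′ n
  words-cong n same = mk↔ₛ′
    (λ (p , l , t) → p , l , subst T (same p) t) (λ (p , l , t) → p , l , subst T (sym (same p)) t)
    (λ _ → word-≡ refl) (λ _ → word-≡ refl)

  accepted : ∀ {accept : ℕ → Bool} z → T (maybe′ accept false z) → Σ ℕ λ e → z ≡ just e
  accepted (just e) _ = e , refl

  lower : Maybe ℕ → Maybe ℕ
  lower (just (suc y)) = just y
  lower _              = nothing

  module Run {S : Set} (next : ℕ → S → Maybe ℕ) where
    run : ℕ → List S → Maybe ℕ
    run y []      = just y
    run y (s ∷ p) = next y s >>= λ y′ → run y′ p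

    valid : (ℕ → Bool) → ℕ → List S → Bool
    valid accept y p = maybe′ accept false (run y p)

  run-cong : ∀ {S : Set} (next next′ : ℕ → S → Maybe ℕ) → (∀ y s → next y s ≡ next′ y s) →
             ∀ y p → Run.run next y p ≡ Run.run next′ y p
  run-cong next next′ same y []      = refl
  run-cong next next′ same y (s ∷ p) rewrite same y s with next′ y s
  ... | nothing = refl
  ... | just y′ = run-cong next next′ same y′ p

  -- A path from level y+1 either never touches level 0, and is then a path
  -- of the lowered automaton (levels shifted down by one), or it splits
  -- uniquely as  q ++ back e ∷ r  with q a lowered path from y ending at a
  -- level e with canReturn e, followed by a path r from level 0.
  module FirstReturnSplit {S : Set} (next : ℕ → S → Maybe ℕ) (back : ℕ → S) (canReturn : ℕ → Bool)
    (back-returns : ∀ e → T (canReturn e) → next (suc e) (back e) ≡ just 0)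
    (only-back-returns : ∀ e s → next (suc e) s ≡ just 0 → T (canReturn e) × s ≡ back e) where
    open Run next

    -- the automaton on levels ≥ 1, relabelled so that level y+1 becomes y
    lowered : ℕ → S → Maybe ℕ
    lowered y s = lower (next (suc y) s)
    module Low = Run lowered

    data Split : Set where
      never-returns : Split
      returns       : List S → S → List S → Split

    cons : S → Split → Split
    cons s never-returns   = never-returns
    cons s (returns q t r) = returns (s ∷ q) t r

    split : ℕ → List S → Split
    split-at : S → List S → Maybe ℕ → Split
    split y []      = never-returns
    split y (s ∷ p) = split-at s p (next (suc y) s)
    split-at s p (just zero)     = returns [] s p
    split-at s p (just (suc y′)) = cons s (split y′ p)
    split-at s p nothing         = never-returns

    lowered-run : ∀ y p e → Low.run y p ≡ just e → run (suc y) p ≡ just (suc e)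
    lowered-run y []      e refl = refl
    lowered-run y (s ∷ p) e ran with next (suc y) s
    ... | just (suc y′) = lowered-run y′ p e ran

    run-after-return : ∀ y q e s r → Low.run y q ≡ just e → next (suc e) s ≡ just 0 →
                       run (suc y) (q ++ s ∷ r) ≡ run 0 r
    run-after-return y []       e s r refl ret rewrite ret = refl
    run-after-return y (s′ ∷ q) e s r ran  ret with next (suc y) s′
    ... | just (suc y′) = run-after-return y′ q e s r ran ret

    split-lowered : ∀ y p e → Low.run y p ≡ just e → split y p ≡ never-returns
    split-lowered y []      e ran = refl
    split-lowered y (s ∷ p) e ran with next (suc y) s
    ... | just (suc y′) rewrite split-lowered y′ p e ran = refl

    split-returning : ∀ y q e s r → Low.run y q ≡ just e → next (suc e) s ≡ just 0 →
                      split y (q ++ s ∷ r) ≡ returns q s r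
    split-returning y []       e s r refl ret rewrite ret = refl
    split-returning y (s′ ∷ q) e s r ran  ret with next (suc y) s′
    ... | just (suc y′) rewrite split-returning y′ q e s r ran ret = refl

    never-returns-lowered : ∀ y p f → run (suc y) p ≡ just f → split y p ≡ never-returns →
                            Σ ℕ λ e → f ≡ suc e × Low.run y p ≡ just e
    never-returns-lowered y [] f refl _ = y , refl , refl
    never-returns-lowered y (s ∷ p) f ran never with next (suc y) s
    never-returns-lowered y (s ∷ p) f ()  never | nothing
    never-returns-lowered y (s ∷ p) f ran ()    | just zero
    ... | just (suc y′) with split y′ p in split-p
    ...   | never-returns = never-returns-lowered y′ p f ran split-p

    returns-decomposes : ∀ y p q s r → split y p ≡ returns q s r →
      p ≡ q ++ s ∷ r × (Σ ℕ λ e → Low.run y q ≡ just e × next (suc e) s ≡ just 0)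
    returns-decomposes y [] q s r ()
    returns-decomposes y (s′ ∷ p) q s r sp with next (suc y) s′ in step
    returns-decomposes y (s′ ∷ p) q s r () | nothing
    returns-decomposes y (s′ ∷ p) .[] .s′ .p refl | just zero = refl , y , refl , step
    ... | just (suc y′) with split y′ p in split-p
    returns-decomposes y (s′ ∷ p) q s r () | just (suc y′) | never-returns
    returns-decomposes y (s′ ∷ p) .(s′ ∷ q′) .s .r refl | just (suc y′) | returns q′ s r
      with returns-decomposes y′ p q′ s r split-p
    ... | refl , e , ran , ret = refl , e , trans (cong (λ m → lower m >>= λ y″ → Low.run y″ q′) step) ran , ret

    module Decomposition (accept : ℕ → Bool) (y m : ℕ) where
      Paths Lowered Returning : Set
      Paths     = Words (valid accept (suc y)) m
      Lowered   = Words (Low.valid (accept ∘ suc) y) m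
      Returning = (Words (Low.valid canReturn y) ⋆ Words (valid accept 0)) m

      lowered-of-valid : ∀ p → T (valid accept (suc y) p) → split y p ≡ never-returns →
                         T (Low.valid (accept ∘ suc) y p)
      lowered-of-valid p ok never with run (suc y) p in ran
      ... | just f with never-returns-lowered y p f ran never
      ...   | e , refl , low = subst T (sym (cong (maybe′ (accept ∘ suc) false) low)) ok

      valid-of-lowered : ∀ p → T (Low.valid (accept ∘ suc) y p) → T (valid accept (suc y) p)
      valid-of-lowered p ok with Low.run y p in low
      ... | just e = subst T (sym (cong (maybe′ accept false) (lowered-run y p e low))) ok

      join : List S → List S → List S
      join q r = q ++ back (fromMaybe 0 (Low.run y q)) ∷ r

      length-join : ∀ (q : List S) s r → length (q ++ s ∷ r) ≡ suc (length q ℕ.+ length r)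
      length-join q s r = trans (Listₚ.length-++ q) (ℕₚ.+-suc (length q) (length r))

      join-valid : ∀ q r → T (Low.valid canReturn y q) → T (valid accept 0 r) →
                   T (valid accept (suc y) (join q r))
      join-valid q r q-ok r-ok with Low.run y q in low
      ... | just e = subst T (sym (cong (maybe′ accept false)
                                       (run-after-return y q e (back e) r low (back-returns e q-ok)))) r-ok

      split-join : ∀ q r → T (Low.valid canReturn y q) →
                   split y (join q r) ≡ returns q (back (fromMaybe 0 (Low.run y q))) r
      split-join q r q-ok with Low.run y q in low
      ... | just e = split-returning y q e (back e) r low (back-returns e q-ok)

      to-with : ∀ p → length p ≡ m → T (valid accept (suc y) p) →
                ∀ sp → split y p ≡ sp → Lowered ⊎ Returning
      to-with p l ok never-returns sp = inj₁ (p , l , lowered-of-valid p ok sp)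
      to-with p l ok (returns q s r) sp with returns-decomposes y p q s r sp
      ... | refl , e , low , ret = inj₂ (length q , length r , trans (sym (length-join q s r)) l ,
            (q , refl , subst T (sym (cong (maybe′ canReturn false) low)) (proj₁ (only-back-returns e s ret))) ,
            (r , refl , subst T (cong (maybe′ accept false) (run-after-return y q e s r low ret)) ok))

      to : Paths → Lowered ⊎ Returning
      to (p , l , ok) = to-with p l ok (split y p) refl

      from : Lowered ⊎ Returning → Paths
      from (inj₁ (p , l , ok)) = p , l , valid-of-lowered p ok
      from (inj₂ (_ , _ , l , (q , refl , q-ok) , (r , refl , r-ok))) =
        join q r , trans (length-join q _ r) l , join-valid q r q-ok r-ok

      from∘to : ∀ x → from (to x) ≡ x
      from∘to (p , l , ok) = go (split y p) refl
        where
        go : ∀ sp (eq : split y p ≡ sp) → from (to-with p l ok sp eq) ≡ (p , l , ok)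
        go never-returns   _  = word-≡ refl
        go (returns q s r) sp with returns-decomposes y p q s r sp
        ... | refl , e , low , ret with only-back-returns e s ret
        ...   | _ , refl = word-≡ (cong (λ z → q ++ back (fromMaybe 0 z) ∷ r) low)

      to∘from : ∀ x → to (from x) ≡ x
      to∘from (inj₁ (p , l , ok)) = go (split y p) refl
        where
        go : ∀ sp (eq : split y p ≡ sp) → to-with p l (valid-of-lowered p ok) sp eq ≡ inj₁ (p , l , ok)
        go never-returns   _  = cong inj₁ (word-≡ refl)
        go (returns q s r) sp with accepted (Low.run y p) ok
        ... | e , low with trans (sym sp) (split-lowered y p e low)
        ...   | ()
      to∘from (inj₂ (_ , _ , l , (q , refl , q-ok) , (r , refl , r-ok))) = go (split y (join q r)) refl
        where
        go : ∀ sp (eq : split y (join q r) ≡ sp) →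
             to-with (join q r) (trans (length-join q _ r) l) (join-valid q r q-ok r-ok) sp eq
             ≡ inj₂ (length q , length r , l , (q , refl , q-ok) , (r , refl , r-ok))
        go sp eq with trans (sym eq) (split-join q r q-ok)
        go .(returns q _ r) eq | refl with returns-decomposes y (join q r) q _ r eq
        ... | refl , _ , _ , _ =
          cong inj₂ (cong₂ (λ a b → length q , length r , a , b)
                           (ℕₚ.≡-irrelevant _ _) (cong₂ _,_ (word-≡ refl) (word-≡ refl)))

      decomposition : Paths ↔ (Lowered ⊎ Returning)
      decomposition = mk↔ₛ′ to from to∘from from∘to

module PartialSubtraction where
  open import Data.Maybe using (Maybe; just; nothing)
  open Automata using (lower)

  _-?_ : ℕ → ℕ → Maybe ℕ
  y     -? zero  = just y
  zero  -? suc k = nothing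
  suc y -? suc k = y -? k

  lower-sub : ∀ y k → lower (y -? k) ≡ y -? suc k
  lower-sub zero    zero    = refl
  lower-sub zero    (suc k) = refl
  lower-sub (suc y) zero    = refl
  lower-sub (suc y) (suc k) = lower-sub y k

  sub-self : ∀ n → n -? n ≡ just 0
  sub-self zero    = refl
  sub-self (suc n) = sub-self n

  sub-reaches-0 : ∀ y k → y -? k ≡ just 0 → k ≡ y
  sub-reaches-0 zero    zero    _   = refl
  sub-reaches-0 (suc y) (suc k) eq = cong suc (sub-reaches-0 y k eq)

  sub-≤ : ∀ y k {r} → y -? k ≡ just r → r ℕ.≤ y
  sub-≤ y       zero    refl = ℕₚ.≤-refl
  sub-≤ (suc y) (suc k) eq   = ℕₚ.m≤n⇒m≤1+n (sub-≤ y k eq)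

  sub-just : ∀ y k {r} → y -? k ≡ just r → y ℤ.⊖ k ≡ + r
  sub-just y       zero    refl = ℤₚ.⊖-≥ z≤n
  sub-just (suc y) (suc k) eq   = trans (ℤₚ.[1+m]⊖[1+n]≡m⊖n y k) (sub-just y k eq)

  sub-nothing : ∀ y k → y -? k ≡ nothing → Σ ℕ λ n → y ℤ.⊖ k ≡ ℤ.-[1+ n ]
  sub-nothing zero    (suc k) _  = k , refl
  sub-nothing (suc y) (suc k) eq =
    let n , y⊖k = sub-nothing y k eq in n , trans (ℤₚ.[1+m]⊖[1+n]≡m⊖n y k) y⊖k

-- When
-- level 1 is allowed they satisfy the first-return recursion
--   D 0 ≅ 1,   D (m+1) ≅ D′ m ⊎ (D′ ⋆ D) m,
-- where D′ are the paths for the shifted predicate  allowed ∘ suc: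
-- after the initial up-step, the path either stays at levels ≥ 1, or it
-- first returns to 0 by a single down-step.
module DeutschAutomaton where
  open import Data.Bool using (Bool; true; false; T; if_then_else_)
  open import Data.Maybe using (Maybe; just; nothing; maybe′; _>>=_)
  open import Data.List using (List; []; _∷_)
  open import Data.Unit using (⊤; tt)
  open import Data.Empty using (⊥; ⊥-elim)
  open import Function.Bundles using (_↔_; mk↔ₛ′)
  open import Function.Properties.Inverse using (↔-trans)
  open Automata
  open PartialSubtraction
  open Counting using (FirstReturn)

  deutschStep : (ℕ → Bool) → ℕ → DStep → Maybe ℕ
  deutschStep allowed y up       = if allowed (suc y) then just (suc y) else nothing
  deutschStep allowed y (down k) = y -? suc k

  DeutschPaths : (ℕ → Bool) → ℕ → Set
  DeutschPaths allowed = Words (Run.valid (deutschStep allowed) (λ _ → true) 0)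

  lowered-deutschStep : ∀ allowed y s →
    lower (deutschStep allowed (suc y) s) ≡ deutschStep (allowed ∘ suc) y s
  lowered-deutschStep allowed y up with allowed (suc (suc y))
  ... | true  = refl
  ... | false = refl
  lowered-deutschStep allowed y (down k) = lower-sub y k

  down-returns : ∀ allowed e → T true → deutschStep allowed (suc e) (down e) ≡ just 0
  down-returns allowed e _ = sub-self e

  only-down-returns : ∀ allowed e s → deutschStep allowed (suc e) s ≡ just 0 → T true × s ≡ down e
  only-down-returns allowed e up reaches0 with allowed (suc (suc e))
  only-down-returns allowed e up () | true
  only-down-returns allowed e up () | false
  only-down-returns allowed e (down k) reaches0 = tt , cong down (sub-reaches-0 e k reaches0)

  empty-path : ∀ allowed → DeutschPaths allowed 0 ↔ ⊤
  empty-path allowed = mk↔ₛ′ (λ _ → tt) (λ _ → [] , refl , tt) (λ _ → refl) (λ { ([] , refl , tt) → refl })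

  first-step-up : ∀ allowed → allowed 1 ≡ true → ∀ m →
    DeutschPaths allowed (suc m) ↔ Words (Run.valid (deutschStep allowed) (λ _ → true) 1) m
  first-step-up allowed allowed1 m = mk↔ₛ′ to from (λ _ → word-≡ refl) from∘to
    where
    up-from-0 : deutschStep allowed 0 up ≡ just 1
    up-from-0 rewrite allowed1 = refl
    continue : List DStep → Maybe ℕ → Bool
    continue p z = maybe′ (λ _ → true) false (z >>= λ y → Run.run (deutschStep allowed) y p)
    to : DeutschPaths allowed (suc m) → Words (Run.valid (deutschStep allowed) (λ _ → true) 1) m
    to (up ∷ p , l , ok)     = p , ℕₚ.suc-injective l , subst T (cong (continue p) up-from-0) ok
    to (down k ∷ p , l , ())
    from : Words (Run.valid (deutschStep allowed) (λ _ → true) 1) m → DeutschPaths allowed (suc m)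
    from (p , l , ok) = up ∷ p , cong suc l , subst T (sym (cong (continue p) up-from-0)) ok
    from∘to : ∀ x → from (to x) ≡ x
    from∘to (up ∷ p , l , ok) = word-≡ refl
    from∘to (down k ∷ p , l , ())

  no-first-step : ∀ allowed → allowed 1 ≡ false → ∀ m → DeutschPaths allowed (suc m) ↔ ⊥
  no-first-step allowed forbidden1 m = mk↔ₛ′ impossible (λ ()) (λ ()) (λ x → ⊥-elim (impossible x))
    where
    impossible : DeutschPaths allowed (suc m) → ⊥
    impossible (up ∷ p , l , ok) rewrite forbidden1 = ok
    impossible (down k ∷ p , l , ())

  module Recursion (allowed : ℕ → Bool) (allowed1 : allowed 1 ≡ true) where
    open FirstReturnSplit (deutschStep allowed) down (λ _ → true)
                          (down-returns allowed) (only-down-returns allowed)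

    Raised : ℕ → Set
    Raised = Words (Low.valid (λ _ → true) 0)

    raised-shifted : ∀ m → Raised m ↔ DeutschPaths (allowed ∘ suc) m
    raised-shifted m = words-cong m (λ p →
      cong (maybe′ (λ _ → true) false) (run-cong lowered (deutschStep (allowed ∘ suc)) (lowered-deutschStep allowed) 0 p))

    first-return : FirstReturn (DeutschPaths allowed) Raised Raised
    first-return = record
      { empty = empty-path allowed
      ; step  = λ m → ↔-trans (first-step-up allowed allowed1 m)
                              (Decomposition.decomposition (λ _ → true) 0 m) }

-- Motzkin paths as runs of an automaton that accepts only at level 0.  They
-- satisfy the first-return recursion  M (m+1) ≅ M m ⊎ (M ⋆ M) m  (first
-- step flat, or an up-step followed by the first return to level 0).
module MotzkinAutomaton where
  open import Data.Bool using (Bool; true; false; T)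
  open import Data.Maybe using (Maybe; just; nothing; maybe′)
  open import Data.List using ([]; _∷_)
  open import Data.Sum using (_⊎_; inj₁; inj₂)
  open import Data.Unit using (⊤; tt)
  open import Data.Empty using (⊥; ⊥-elim)
  open import Function.Bundles using (_↔_; mk↔ₛ′)
  open import Function.Properties.Inverse using (↔-trans; ↔-refl)
  open import Data.Sum.Function.Propositional using (_⊎-↔_)
  open Automata
  open PartialSubtraction
  open Counting using (FirstReturn)

  motzkinStep : ℕ → MStep → Maybe ℕ
  motzkinStep y U = just (suc y)
  motzkinStep y F = just y
  motzkinStep y D = y -? 1

  isZero : ℕ → Bool
  isZero zero    = true
  isZero (suc _) = false

  MotzkinPaths : ℕ → Set
  MotzkinPaths = Words (Run.valid motzkinStep isZero 0)

  lowered-motzkinStep : ∀ y s → lower (motzkinStep (suc y) s) ≡ motzkinStep y s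
  lowered-motzkinStep y U = refl
  lowered-motzkinStep y F = refl
  lowered-motzkinStep y D = lower-sub y 0

  D-returns : ∀ e → T (isZero e) → motzkinStep (suc e) D ≡ just 0
  D-returns zero _ = refl

  only-D-returns : ∀ e s → motzkinStep (suc e) s ≡ just 0 → T (isZero e) × s ≡ D
  only-D-returns zero D refl = tt , refl

  empty-path : MotzkinPaths 0 ↔ ⊤
  empty-path = mk↔ₛ′ (λ _ → tt) (λ _ → [] , refl , tt) (λ _ → refl) (λ { ([] , refl , tt) → refl })

  first-step : ∀ m → MotzkinPaths (suc m) ↔ (MotzkinPaths m ⊎ Words (Run.valid motzkinStep isZero 1) m)
  first-step m = mk↔ₛ′ to from to∘from from∘to
    where
    to : MotzkinPaths (suc m) → MotzkinPaths m ⊎ Words (Run.valid motzkinStep isZero 1) m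
    to (F ∷ p , l , ok) = inj₁ (p , ℕₚ.suc-injective l , ok)
    to (U ∷ p , l , ok) = inj₂ (p , ℕₚ.suc-injective l , ok)
    to (D ∷ p , l , ())
    from : MotzkinPaths m ⊎ Words (Run.valid motzkinStep isZero 1) m → MotzkinPaths (suc m)
    from (inj₁ (p , l , ok)) = F ∷ p , cong suc l , ok
    from (inj₂ (p , l , ok)) = U ∷ p , cong suc l , ok
    to∘from : ∀ x → to (from x) ≡ x
    to∘from (inj₁ _) = cong inj₁ (word-≡ refl)
    to∘from (inj₂ _) = cong inj₂ (word-≡ refl)
    from∘to : ∀ x → from (to x) ≡ x
    from∘to (F ∷ p , l , ok) = word-≡ refl
    from∘to (U ∷ p , l , ok) = word-≡ refl
    from∘to (D ∷ p , l , ())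

  drop-empty : ∀ {A B : Set} → (A → ⊥) → (A ⊎ B) ↔ B
  drop-empty ¬a = mk↔ₛ′ (λ { (inj₁ a) → ⊥-elim (¬a a) ; (inj₂ b) → b }) inj₂ (λ _ → refl)
                        (λ { (inj₁ a) → ⊥-elim (¬a a) ; (inj₂ b) → refl })

  module Recursion where
    open FirstReturnSplit motzkinStep (λ _ → D) isZero D-returns only-D-returns

    Raised : ℕ → Set
    Raised = Words (Low.valid isZero 0)

    raised-motzkin : ∀ m → Raised m ↔ MotzkinPaths m
    raised-motzkin m = words-cong m (λ p →
      cong (maybe′ isZero false) (run-cong lowered motzkinStep lowered-motzkinStep 0 p))

    -- a path from level 1 cannot end at level 0 without returning to it
    never-lowered : ∀ m → Decomposition.Lowered isZero 0 m → ⊥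
    never-lowered m (p , _ , ok) with Low.run 0 p
    never-lowered m (p , _ , ()) | just _
    never-lowered m (p , _ , ()) | nothing

    first-return : FirstReturn MotzkinPaths MotzkinPaths Raised
    first-return = record
      { empty = empty-path
      ; step  = λ m → ↔-trans (first-step m)
                  (↔-refl ⊎-↔ ↔-trans (Decomposition.decomposition isZero 0 m)
                                      (drop-empty (never-lowered m))) }

-- The path sets of the statement, defined through the list of visited
-- levels, correspond to the automaton paths: a list of steps keeps all its
-- levels inside a region In exactly when the automaton, which forbids the
-- steps leaving In, accepts it.
module Correspondence where
  open import Data.Integer using (_+_; _≤_; +≤+; -[1+_])
  open import Data.Bool using (Bool; true; false; T)
  open import Data.Maybe using (Maybe; just; nothing; maybe′)
  open import Data.List using (List; []; _∷_; length)
  open import Data.List.Relation.Unary.All as All using (All; []; _∷_)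
  open import Data.Unit using (tt)
  open import Data.Empty using (⊥; ⊥-elim)
  open import Function.Bundles using (_↔_; mk↔ₛ′)
  open import Axiom.UniquenessOfIdentityProofs using (module Decidable⇒UIP)
  open Automata
  open PartialSubtraction
  open DeutschAutomaton using (deutschStep; DeutschPaths)
  open MotzkinAutomaton using (motzkinStep; isZero; MotzkinPaths)

  levels : {S : Set} → (S → ℤ) → ℤ → List S → List ℤ
  levels δ z []      = z ∷ []
  levels δ z (s ∷ p) = z ∷ levels δ (z + δ s) p

  final : {S : Set} → (S → ℤ) → ℤ → List S → ℤ
  final δ z []      = z
  final δ z (s ∷ p) = final δ (z + δ s) p

  dLevels≡levels : ∀ z p → dLevelsFrom z p ≡ levels dδ z p
  dLevels≡levels z []      = refl
  dLevels≡levels z (s ∷ p) = cong (z ∷_) (dLevels≡levels (z + dδ s) p)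

  mLevels≡levels : ∀ z p → mLevelsFrom z p ≡ levels mδ z p
  mLevels≡levels z []      = refl
  mLevels≡levels z (s ∷ p) = cong (z ∷_) (mLevels≡levels (z + mδ s) p)

  mFinal≡final : ∀ z p → mFinal z p ≡ final mδ z p
  mFinal≡final z []      = refl
  mFinal≡final z (s ∷ p) = mFinal≡final (z + mδ s) p

  first-level : ∀ {S : Set} {δ : S → ℤ} {In : ℤ → Set} {z} p → All In (levels δ z p) → In z
  first-level []      (inz ∷ _) = inz
  first-level (_ ∷ _) (inz ∷ _) = inz

  module LevelRuns {S : Set} (δ : S → ℤ) (next : ℕ → S → Maybe ℕ) (In : ℤ → Set)
    (step-just    : ∀ y s {y′} → next y s ≡ just y′ → + y + δ s ≡ + y′)
    (step-nothing : ∀ y s → next y s ≡ nothing → In (+ y + δ s) → ⊥)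
    (step-in      : ∀ y s {y′} → In (+ y) → next y s ≡ just y′ → In (+ y′)) where
    open Run next

    run-of-levels : ∀ p y {z} → z ≡ + y → All In (levels δ z p) →
                    Σ ℕ λ e → run y p ≡ just e × final δ z p ≡ + e
    run-of-levels []      y z≡y _          = y , refl , z≡y
    run-of-levels (s ∷ p) y z≡y (_ ∷ rest) with next y s in step
    ... | just y′ = run-of-levels p y′ (trans (cong (_+ δ s) z≡y) (step-just y s step)) rest
    ... | nothing = ⊥-elim (step-nothing y s step (subst In (cong (_+ δ s) z≡y) (first-level p rest)))

    levels-of-run : ∀ p y {z e} → z ≡ + y → In z → run y p ≡ just e →
                    All In (levels δ z p) × final δ z p ≡ + e
    levels-of-run []      y z≡y inz refl = inz ∷ [] , z≡y
    levels-of-run (s ∷ p) y z≡y inz ran with next y s in step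
    ... | just y′ =
      let z′≡y′ = trans (cong (_+ δ s) z≡y) (step-just y s step)
          rest , fin = levels-of-run p y′ z′≡y′ (subst In (sym z′≡y′) (step-in y s (subst In z≡y inz) step)) ran
      in inz ∷ rest , fin

  -- booleans for  y ≤ h,  by structural recursion so that  leq (1+y) (1+h) = leq y h
  leq : ℕ → ℕ → Bool
  leq zero    _       = true
  leq (suc m) zero    = false
  leq (suc m) (suc n) = leq m n

  leq-sound : ∀ m n → T (leq m n) → m ℕ.≤ n
  leq-sound zero    n       _  = z≤n
  leq-sound (suc m) (suc n) le = s≤s (leq-sound m n le)

  leq-complete : ∀ {m n} → m ℕ.≤ n → T (leq m n)
  leq-complete z≤n       = tt
  leq-complete (s≤s m≤n) = leq-complete m≤n

  module DeutschRegion (allowed : ℕ → Bool) (In : ℤ → Set)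
    (In-irrelevant : ∀ {z} (a b : In z) → a ≡ b)
    (allowed⇒In : ∀ {y} → T (allowed y) → In (+ y)) (In⇒allowed : ∀ {y} → In (+ y) → T (allowed y))
    (negative-out : ∀ {n} → In -[1+ n ] → ⊥) (down-closed : ∀ {x y} → x ℕ.≤ y → In (+ y) → In (+ x)) where

    up-height : ∀ y → + y + dδ up ≡ + suc y
    up-height y = cong +_ (ℕₚ.+-comm y 1)

    step-just : ∀ y s {y′} → deutschStep allowed y s ≡ just y′ → + y + dδ s ≡ + y′
    step-just y up step with allowed (suc y)
    step-just y up refl | true = up-height y
    step-just y (down k) step = sub-just y (suc k) step

    step-nothing : ∀ y s → deutschStep allowed y s ≡ nothing → In (+ y + dδ s) → ⊥
    step-nothing y up step in′ with allowed (suc y) in up-allowed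
    step-nothing y up ()   in′ | true
    step-nothing y up refl in′ | false =
      subst T up-allowed (In⇒allowed (subst In (up-height y) in′))
    step-nothing y (down k) step in′ =
      let _ , negative = sub-nothing y (suc k) step in negative-out (subst In negative in′)

    step-in : ∀ y s {y′} → In (+ y) → deutschStep allowed y s ≡ just y′ → In (+ y′)
    step-in y up iny step with allowed (suc y) in up-allowed
    step-in y up iny refl | true = allowed⇒In (subst T (sym up-allowed) tt)
    step-in y (down k) iny step = down-closed (sub-≤ y (suc k) step) iny

    open LevelRuns dδ (deutschStep allowed) In step-just step-nothing step-in

    correspondence : ∀ n → In (+ 0) →
      (Σ (List DStep) λ p → length p ≡ n × All In (dLevels p)) ↔ DeutschPaths allowed n
    correspondence n in0 = mk↔ₛ′ to from (λ _ → word-≡ refl) from∘to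
      where
      to : (Σ (List DStep) λ p → length p ≡ n × All In (dLevels p)) → DeutschPaths allowed n
      to (p , l , inside) =
        let _ , ran , _ = run-of-levels p 0 refl (subst (All In) (dLevels≡levels (+ 0) p) inside)
        in p , l , subst (λ z → T (maybe′ (λ _ → true) false z)) (sym ran) tt
      from : DeutschPaths allowed n → (Σ (List DStep) λ p → length p ≡ n × All In (dLevels p))
      from (p , l , ok) =
        let _ , ran = accepted (Run.run (deutschStep allowed) 0 p) ok
        in p , l , subst (All In) (sym (dLevels≡levels (+ 0) p)) (proj₁ (levels-of-run p 0 refl in0 ran))
      from∘to : ∀ x → from (to x) ≡ x
      from∘to (p , l , inside) = cong (λ a → p , l , a) (All.irrelevant In-irrelevant _ _)

  InStrip : ℕ → ℤ → Set
  InStrip h z = + 0 ≤ z × z ≤ + h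

  bounded-correspondence : ∀ h n → BoundedOpenDeutsch h n ↔ DeutschPaths (λ y → leq y h) n
  bounded-correspondence h n = Strip.correspondence n (+≤+ z≤n , +≤+ z≤n)
    where
    module Strip = DeutschRegion (λ y → leq y h) (InStrip h)
      (λ (a , b) (c , d) → cong₂ _,_ (ℤₚ.≤-irrelevant a c) (ℤₚ.≤-irrelevant b d))
      (λ {y} y≤h → +≤+ z≤n , +≤+ (leq-sound y h y≤h))
      (λ (_ , y≤h) → leq-complete (ℤₚ.drop‿+≤+ y≤h))
      (λ ())
      (λ x≤y (_ , y≤h) → +≤+ z≤n , +≤+ (ℕₚ.≤-trans x≤y (ℤₚ.drop‿+≤+ y≤h)))

  open-correspondence : ∀ n → OpenDeutsch n ↔ DeutschPaths (λ _ → true) n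
  open-correspondence n = Unbounded.correspondence n (+≤+ z≤n)
    where
    module Unbounded = DeutschRegion (λ _ → true) (+ 0 ≤_) ℤₚ.≤-irrelevant
      (λ _ → +≤+ z≤n) (λ _ → tt) (λ ()) (λ _ _ → +≤+ z≤n)

  module MotzkinLevels where
    step-just : ∀ y s {y′} → motzkinStep y s ≡ just y′ → + y + mδ s ≡ + y′
    step-just y U refl = cong +_ (ℕₚ.+-comm y 1)
    step-just y F refl = cong +_ (ℕₚ.+-identityʳ y)
    step-just y D step = sub-just y 1 step

    step-nothing : ∀ y s → motzkinStep y s ≡ nothing → + 0 ≤ + y + mδ s → ⊥
    step-nothing y D step nonneg with sub-nothing y 1 step
    ... | _ , negative with subst (+ 0 ≤_) negative nonneg
    ...   | ()

    open LevelRuns mδ motzkinStep (+ 0 ≤_) step-just step-nothing (λ _ _ _ _ → +≤+ z≤n) public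

  isZero-sound : ∀ {e} → T (isZero e) → e ≡ 0
  isZero-sound {zero} _ = refl

  motzkin-correspondence : ∀ n → Motzkin n ↔ MotzkinPaths n
  motzkin-correspondence n = mk↔ₛ′ to from (λ _ → word-≡ refl) from∘to
    where
    open MotzkinLevels
    to : Motzkin n → MotzkinPaths n
    to (p , l , nonneg , ends0) =
      let e , ran , fin = run-of-levels p 0 refl (subst (All (+ 0 ≤_)) (mLevels≡levels (+ 0) p) nonneg)
          e≡0 = ℤₚ.+-injective (trans (sym fin) (trans (sym (mFinal≡final (+ 0) p)) ends0))
      in p , l , subst (λ z → T (maybe′ isZero false z)) (sym (trans ran (cong just e≡0))) tt
    from : MotzkinPaths n → Motzkin n
    from (p , l , ok) =
      let e , ran = accepted (Run.run motzkinStep 0 p) ok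
          nonneg , fin = levels-of-run p 0 refl (+≤+ z≤n) ran
          e≡0 = isZero-sound (subst (λ z → T (maybe′ isZero false z)) ran ok)
      in p , l , subst (All (+ 0 ≤_)) (sym (mLevels≡levels (+ 0) p)) nonneg
               , trans (mFinal≡final (+ 0) p) (trans fin (cong +_ e≡0))
    from∘to : ∀ x → from (to x) ≡ x
    from∘to (p , l , nonneg , ends0) =
      cong₂ (λ a b → p , l , a , b) (All.irrelevant ℤₚ.≤-irrelevant _ _)
                                    (Decidable⇒UIP.≡-irrelevant ℤ._≟_ _ _)

module StripSeries where
  open import Data.Fin.Properties using (0↔⊥; 1↔⊤)
  open import Function.Properties.Inverse using (↔-trans; ↔-sym)
  open Counting
  open DeutschAutomaton
  open Correspondence using (leq)
  open GeneratingFunctions using (first-return-series)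
  open SeriesRing using (_≋_; coeffwise)

  Strip : ℕ → ℕ → Set
  Strip h = DeutschPaths (λ y → leq y h)

  module StepUp (h : ℕ) = Recursion (λ y → leq y (suc h)) refl

  -- strip h has finitely many paths of each length: for h = 0 only the empty path,
  -- for h + 1 by the first-return recursion over strip h
  strip-sized : ∀ h n → Sized (Strip h n)
  strip-sized zero    zero    = 1 , ↔-trans 1↔⊤ (↔-sym (empty-path _))
  strip-sized zero    (suc m) = 0 , ↔-trans 0↔⊥ (↔-sym (no-first-step _ refl m))
  strip-sized (suc h) = sized-family (StepUp.first-return h) raised raised
    where
    raised : ∀ m → Sized (StepUp.Raised h m)
    raised m = _ , size-↔ (proj₂ (strip-sized h m)) (↔-sym (StepUp.raised-shifted h m))

  strip-count : ℕ → ℕ → ℕ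
  strip-count h n = proj₁ (strip-sized h n)

  G : ℕ → FPS
  G h = gf (strip-count h)

  G-zero : G 0 ≋ 𝟙
  G-zero = coeffwise λ { zero → refl ; (suc n) → refl }

  G-suc : ∀ h → G (suc h) ≋ 𝟙 ⊕ 𝕫 ⊛ G h ⊕ 𝕫 ⊛ 𝕫 ⊛ G h ⊛ G (suc h)
  G-suc h = first-return-series (StepUp.first-return h) (strip-count (suc h)) (strip-count h) (strip-count h)
              (λ k → proj₂ (strip-sized (suc h) k)) raised raised
    where
    raised : ∀ k → HasSize (StepUp.Raised h k) (strip-count h k)
    raised k = size-↔ (proj₂ (strip-sized h k)) (↔-sym (StepUp.raised-shifted h k))

module Solution (v : FPS) (v-eq : v ≈ₛ 𝕫 ⊛ (𝟙 ⊕ v ⊕ v ^ₛ 2)) where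
  open import Data.Bool using (true)
  open import Function.Properties.Inverse using (↔-trans; ↔-sym; ↔-refl)
  open import Algebra.Bundles using (CommutativeRing)
  open SeriesRing
  open SeriesSolver
  open SeriesAlgebra using (motzkinForm; strip-step; quadratic-solution)
  open Counting using (size-unique)
  open GeneratingFunctions using (self-similar-series)
  open StripSeries using (G; G-zero; G-suc; strip-sized)
  open Correspondence using (bounded-correspondence; open-correspondence; motzkin-correspondence)
  module R = CommutativeRing seriesRing
  open R using (_*_; _-_; _≈_; 1#)

  v≈zc : v ≈ 𝕫 ⊛ motzkinForm v
  v≈zc = coeffwise v-eq

  v₀≡0 : v 0 ≡ +0
  v₀≡0 = v-eq 0

  power-shift : ∀ h → v ^ₛ (h ℕ.+ 3) ≡ v ⊛ (v ⊛ v ^ₛ (h ℕ.+ 1))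
  power-shift h = cong (v ^ₛ_) (trans (ℕₚ.+-suc h 2) (cong suc (ℕₚ.+-suc h 1)))

  strip-formula : ∀ h → G h * (1# - v ^ₛ (h ℕ.+ 3)) ≈ motzkinForm v * (1# - v ^ₛ (h ℕ.+ 1))
  strip-formula zero = R.trans (R.*-congʳ {1# - v ^ₛ 3} G-zero)
    (solve 1 (λ v → let o = v :^ 0 in
      o :* (o :- v :* (v :* (v :* o))) := (o :+ v :+ v :* (v :* o)) :* (o :- v :* o)) R.refl v)
  strip-formula (suc h) =
    subst (λ t → G (suc h) * (1# - v * t) ≈ motzkinForm v * (1# - v * v ^ₛ (h ℕ.+ 1)))
          (sym (power-shift h))
          (strip-step (G (suc h)) (G h) 𝕫 v (v ^ₛ (h ℕ.+ 1)) v₀≡0 v≈zc (G-suc h)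
            (subst (λ t → G h * (1# - t) ≈ motzkinForm v * (1# - v ^ₛ (h ℕ.+ 1)))
                   (power-shift h) (strip-formula h)))

  bounded : (h : ℕ) (B : ℕ → ℕ) → (∀ n → HasSize (BoundedOpenDeutsch h n) (B n)) →
    gf B ⊛ (𝟙 ⊖ v ^ₛ (h ℕ.+ 3)) ≈ₛ motzkinForm v ⊛ (𝟙 ⊖ v ^ₛ (h ℕ.+ 1))
  bounded h B sizes = coeff (R.trans (R.*-congʳ {1# - v ^ₛ (h ℕ.+ 3)} (coeffwise B≈G)) (strip-formula h))
    where
    B≈G : gf B ≈ₛ G h
    B≈G n = cong +_ (size-unique (↔-trans (sizes n) (bounded-correspondence h n))
                                 (proj₂ (strip-sized h n)))

  -- the unbounded claims: both counting series solve  X = 1 + zX + z²X²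
  unbounded : (D : ℕ → ℕ) → (∀ n → HasSize (OpenDeutsch n) (D n)) → gf D ≈ₛ motzkinForm v
  unbounded d sizes = coeff (quadratic-solution (gf d) 𝕫 v refl v≈zc
    (self-similar-series first-return d (λ n → ↔-trans (sizes n) (open-correspondence n))
                         (λ k → ↔-sym (raised-shifted k)) (λ k → ↔-sym (raised-shifted k))))
    where open DeutschAutomaton.Recursion (λ _ → true) refl

  motzkin : (M : ℕ → ℕ) → (∀ n → HasSize (Motzkin n) (M n)) → gf M ≈ₛ motzkinForm v
  motzkin m sizes = coeff (quadratic-solution (gf m) 𝕫 v refl v≈zc
    (self-similar-series first-return m (λ n → ↔-trans (sizes n) (motzkin-correspondence n))
                         (λ _ → ↔-refl) (λ k → ↔-sym (raised-motzkin k))))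
    where open MotzkinAutomaton.Recursion

  deutsch≡motzkin : (D M : ℕ → ℕ) → (∀ n → HasSize (OpenDeutsch n) (D n)) →
    (∀ n → HasSize (Motzkin n) (M n)) → ∀ n → D n ≡ M n
  deutsch≡motzkin d m d-sizes m-sizes n =
    ℤₚ.+-injective (trans (unbounded d d-sizes n) (sym (motzkin m m-sizes n)))

open import Data.Nat using (_+_)

mainTheorem3 : (v : FPS) → v ≈ₛ 𝕫 ⊛ (𝟙 ⊕ v ⊕ v ^ₛ 2) →
      ((h : ℕ) (B : ℕ → ℕ) → (∀ n → HasSize (BoundedOpenDeutsch h n) (B n)) →
        gf B ⊛ (𝟙 ⊖ v ^ₛ (h + 3)) ≈ₛ (𝟙 ⊕ v ⊕ v ^ₛ 2) ⊛ (𝟙 ⊖ v ^ₛ (h + 1)))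
      × ((D : ℕ → ℕ) → (∀ n → HasSize (OpenDeutsch n) (D n)) →
        gf D ≈ₛ 𝟙 ⊕ v ⊕ v ^ₛ 2)
      × ((M : ℕ → ℕ) → (∀ n → HasSize (Motzkin n) (M n)) →
        gf M ≈ₛ 𝟙 ⊕ v ⊕ v ^ₛ 2)
      × ((D M : ℕ → ℕ) → (∀ n → HasSize (OpenDeutsch n) (D n)) →
        (∀ n → HasSize (Motzkin n) (M n)) → ∀ n → D n ≡ M n)
mainTheorem3 v v-eq = bounded , unbounded , motzkin , deutsch≡motzkin
  where open Solution v v-eq
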